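{- Let $\mathbb{S},\mathbb{T}$ be theories of the $\lambda\Pi$-calculus modulo rewriting and $\mu$ a theory morphism from $\mathbb{S}$ to $\mathbb{T}$. 1. If $A\equiv B$ in $\mathbb{S}$ for types $A,B$, then $\mu(A)\equiv\mu(B)$ in $\mathbb{T}$. 2. If $K\equiv K'$ in $\mathbb{S}$ for kinds $K,K'$, then $\mu(K)\equiv\mu(K')$ in $\mathbb{T}$.
   Context: Syntax of $\lambda\Pi/\mathcal{R}$: objects $M,N ::= c \mid x \mid \lambda x:A.\,M \mid M\,N$; types $A,B ::= a \mid \Pi x:A.\,B \mid \lambda x:A.\,B \mid A\,M$; kinds $K ::= \mathsf{Type} \mid \Pi x:A.\,K$; plus $\mathsf{Kind}$; $c$ object constants, $a$ type constants; terms quotiented by $\alpha$-equality; substitutions $\theta$ with capture-avoiding application $t\theta$. A theory is a finite sequence of constant declarations $c:A$, $a:K$ and rewrite rules $\ell\hookrightarrow r$. Conversion in a theory $\mathbb{T}$: $\hookrightarrow_{\beta\mathcal{R}}$ (resp. $\hookrightarrow_{\beta\eta\mathcal{R}}$) is the smallest relation closed under term constructors and substitutions generated by $\beta$-reduction (resp. $\beta$-reduction and $\eta$-expansion) and the rewrite rules of $\mathbb{T}$; $\equiv$ denotes its reflexive, symmetric, transitive closure, with the choice of variant (with or without $\eta$) fixed globally; the result holds for either. Typing $\vdash_\mathbb{T}$ is standard LF typing with conversion rules modulo $\equiv$. Theory morphism: given terms $\mu_c$, $\mu_a$ for the constants of $\mathbb{S}$, $\mu$ is defined by $\mu(x)=x$,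 $\mu(c)=\mu_c$, $\mu(a)=\mu_a$, $\mu(M\,N)=\mu(M)\,\mu(N)$, $\mu(A\,M)=\mu(A)\,\mu(M)$, $\mu(\lambda x:A.t)=\lambda x:\mu(A).\mu(t)$, $\mu(\Pi x:A.t)=\Pi x:\mu(A).\mu(t)$, $\mu(\mathsf{Type})=\mathsf{Type}$, $\mu(\mathsf{Kind})=\mathsf{Kind}$. It is a theory morphism $\mathbb{S}\to\mathbb{T}$ when $\vdash_\mathbb{T}\mu_c:\mu(A)$ for each $c:A\in\mathbb{S}$, $\vdash_\mathbb{T}\mu_a:\mu(K)$ for each $a:K\in\mathbb{S}$, and $\mu(\ell)\equiv\mu(r)$ in $\mathbb{T}$ for each rewrite rule $\ell\hookrightarrow r\in\mathbb{S}$. -}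

module Defs where

open import Data.Nat using (ℕ; zero; suc)
open import Data.Fin using (Fin; zero; suc)
open import Data.Bool using (Bool; true; false)
open import Data.List using (List)
open import Data.List.Membership.Propositional using (_∈_)

open import Relation.Binary.PropositionalEquality using (_≡_)
open import Relation.Binary.Construct.Closure.Equivalence using (EqClosure)

-- A single grammar for objects, types, kinds and Kind (as in Dedukti);
-- the syntactic categories of the paper are the predicates IsObj /
-- IsTy / IsKind below.

data Term (n : ℕ) : Set where
  var   : Fin n → Term n
  ocst  : ℕ → Term n
  tcst  : ℕ → Term n
  lam   : Term n → Term (suc n) → Term n
  pi    : Term n → Term (suc n) → Term n
  app   : Term n → Term n → Term n
  type  : Term n
  kind  : Term n

mutual
  data IsObj {n : ℕ} : Term n → Set where
    o-cst : ∀ c → IsObj (ocst c)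
    o-var : ∀ x → IsObj (var x)
    o-lam : ∀ {A M} → IsTy A → IsObj M → IsObj (lam A M)
    o-app : ∀ {M N} → IsObj M → IsObj N → IsObj (app M N)

  data IsTy {n : ℕ} : Term n → Set where
    t-cst : ∀ a → IsTy (tcst a)
    t-pi  : ∀ {A B} → IsTy A → IsTy B → IsTy (pi A B)
    t-lam : ∀ {A B} → IsTy A → IsTy B → IsTy (lam A B)
    t-app : ∀ {A M} → IsTy A → IsObj M → IsTy (app A M)

data IsKind {n : ℕ} : Term n → Set where
  k-type : IsKind type
  k-pi   : ∀ {A K} → IsTy A → IsKind K → IsKind (pi A K)

Ren : ℕ → ℕ → Set
Ren n m = Fin n → Fin m

extR : ∀ {n m} → Ren n m → Ren (suc n) (suc m)
extR ρ zero    = zero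
extR ρ (suc i) = suc (ρ i)

rename : ∀ {n m} → Ren n m → Term n → Term m
rename ρ (var x)   = var (ρ x)
rename ρ (ocst c)  = ocst c
rename ρ (tcst a)  = tcst a
rename ρ (lam A t) = lam (rename ρ A) (rename (extR ρ) t)
rename ρ (pi A t)  = pi (rename ρ A) (rename (extR ρ) t)
rename ρ (app t u) = app (rename ρ t) (rename ρ u)
rename ρ type      = type
rename ρ kind      = kind

weaken : ∀ {n} → Term n → Term (suc n)
weaken = rename suc

close→ : ∀ {n} → Fin 0 → Fin n
close→ ()

weakenClosed : ∀ {n} → Term 0 → Term n
weakenClosed = rename close→

Sub : ℕ → ℕ → Set
Sub n m = Fin n → Term m

extS : ∀ {n m} → Sub n m → Sub (suc n) (suc m)
extS θ zero    = var zero
extS θ (suc i) = weaken (θ i)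

subst : ∀ {n m} → Sub n m → Term n → Term m
subst θ (var x)   = θ x
subst θ (ocst c)  = ocst c
subst θ (tcst a)  = tcst a
subst θ (lam A t) = lam (subst θ A) (subst (extS θ) t)
subst θ (pi A t)  = pi (subst θ A) (subst (extS θ) t)
subst θ (app t u) = app (subst θ t) (subst θ u)
subst θ type      = type
subst θ kind      = kind

single : ∀ {n} → Term n → Sub (suc n) n
single u zero    = u
single u (suc i) = var i

_[_] : ∀ {n} → Term (suc n) → Term n → Term n
t [ u ] = subst (single u) t

-- Theories: finite sequences of declarations c : A, a : K and rewrite
-- rules ℓ ↪ r (ℓ, r may contain k free pattern variables).

data Decl : Set where
  objDecl : ℕ → Term 0 → Decl
  tyDecl  : ℕ → Term 0 → Decl
  rule    : {k : ℕ} → Term k → Term k → Decl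

Theory : Set
Theory = List Decl

data Step (eta : Bool) (T : Theory) {n : ℕ} : Term n → Term n → Set where
  β     : ∀ A t u → Step eta T (app (lam A t) u) (t [ u ])
  η     : eta ≡ true → ∀ t A →
          Step eta T t (lam A (app (weaken t) (var zero)))
  rw    : ∀ {k} {ℓ r : Term k} → rule ℓ r ∈ T → (θ : Sub k n) →
          Step eta T (subst θ ℓ) (subst θ r)
  lamˡ  : ∀ {A A' t} → Step eta T A A' → Step eta T (lam A t) (lam A' t)
  lamʳ  : ∀ {A t t'} → Step eta T t t' → Step eta T (lam A t) (lam A t')
  piˡ   : ∀ {A A' t} → Step eta T A A' → Step eta T (pi A t) (pi A' t)
  piʳ   : ∀ {A t t'} → Step eta T t t' → Step eta T (pi A t) (pi A t')
  appˡ  : ∀ {t t' u} → Step eta T t t' → Step eta T (app t u) (app t' u)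
  appʳ  : ∀ {t u u'} → Step eta T u u' → Step eta T (app t u) (app t u')

Conv : (eta : Bool) (T : Theory) {n : ℕ} → Term n → Term n → Set
Conv eta T = EqClosure (Step eta T)

data Ctx : ℕ → Set where
  ∅   : Ctx 0
  _▸_ : ∀ {n} → Ctx n → Term n → Ctx (suc n)

lookupCtx : ∀ {n} → Ctx n → Fin n → Term n
lookupCtx (Γ ▸ A) zero    = weaken A
lookupCtx (Γ ▸ A) (suc i) = weaken (lookupCtx Γ i)

data Sort : Set where
  sType sKind : Sort

⌜_⌝ : ∀ {n} → Sort → Term n
⌜ sType ⌝ = type
⌜ sKind ⌝ = kind

mutual
  data WfCtx (eta : Bool) (T : Theory) : ∀ {n} → Ctx n → Set where
    wf-∅ : WfCtx eta T ∅
    wf-▸ : ∀ {n} {Γ : Ctx n} {A} →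
           Typed eta T Γ A type → WfCtx eta T (Γ ▸ A)

  data Typed (eta : Bool) (T : Theory) :
             ∀ {n} → Ctx n → Term n → Term n → Set where
    ty-sort : ∀ {n} {Γ : Ctx n} → WfCtx eta T Γ →
              Typed eta T Γ type kind
    ty-var  : ∀ {n} {Γ : Ctx n} → WfCtx eta T Γ → (x : Fin n) →
              Typed eta T Γ (var x) (lookupCtx Γ x)
    ty-ocst : ∀ {n} {Γ : Ctx n} {c A} → WfCtx eta T Γ →
              objDecl c A ∈ T → Typed eta T ∅ A type →
              Typed eta T Γ (ocst c) (weakenClosed A)
    ty-tcst : ∀ {n} {Γ : Ctx n} {a K} → WfCtx eta T Γ →
              tyDecl a K ∈ T → Typed eta T ∅ K kind →
              Typed eta T Γ (tcst a) (weakenClosed K)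
    ty-pi   : ∀ {n} {Γ : Ctx n} {A B} (s : Sort) →
              Typed eta T Γ A type → Typed eta T (Γ ▸ A) B ⌜ s ⌝ →
              Typed eta T Γ (pi A B) ⌜ s ⌝
    ty-lam  : ∀ {n} {Γ : Ctx n} {A B t} (s : Sort) →
              Typed eta T Γ A type → Typed eta T (Γ ▸ A) B ⌜ s ⌝ →
              Typed eta T (Γ ▸ A) t B →
              Typed eta T Γ (lam A t) (pi A B)
    ty-app  : ∀ {n} {Γ : Ctx n} {t u A B} →
              Typed eta T Γ t (pi A B) → Typed eta T Γ u A →
              Typed eta T Γ (app t u) (B [ u ])
    ty-conv : ∀ {n} {Γ : Ctx n} {t A B} (s : Sort) →
              Typed eta T Γ t A → Typed eta T Γ B ⌜ s ⌝ →
              Conv eta T A B → Typed eta T Γ t B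

-- The data of μ: a term μ_c for each object constant
-- and μ_a for each type constant; they are closed terms (Term 0), as is
-- forced for declared constants by the typing conditions ⊢_T μ_c : μ(A)
-- in the empty context.

record MorphData : Set where
  field
    μo : ℕ → Term 0
    μt : ℕ → Term 0

applyμ : MorphData → ∀ {n} → Term n → Term n
applyμ μ (var x)   = var x
applyμ μ (ocst c)  = weakenClosed (MorphData.μo μ c)
applyμ μ (tcst a)  = weakenClosed (MorphData.μt μ a)
applyμ μ (lam A t) = lam (applyμ μ A) (applyμ μ t)
applyμ μ (pi A t)  = pi (applyμ μ A) (applyμ μ t)
applyμ μ (app t u) = app (applyμ μ t) (applyμ μ u)
applyμ μ type      = type
applyμ μ kind      = kind

record IsTheoryMorphism (eta : Bool) (S T : Theory) (μ : MorphData) : Set where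
  field
    on-obj  : ∀ {c A} → objDecl c A ∈ S →
              Typed eta T ∅ (MorphData.μo μ c) (applyμ μ A)
    on-ty   : ∀ {a K} → tyDecl a K ∈ S →
              Typed eta T ∅ (MorphData.μt μ a) (applyμ μ K)
    on-rule : ∀ {k} {ℓ r : Term k} → rule ℓ r ∈ S →
              Conv eta T (applyμ μ ℓ) (applyμ μ r)

{-# OPTIONS --safe #-}
module Submission where

-- A morphism fixes variables and sends constants to closed terms, so it
-- commutes with renaming and substitution.  Hence it maps a β-step to a
-- β-step, an η-expansion to an η-expansion, and an instance ℓθ ↪ rθ of a
-- rule of S to μ(ℓ)μ(θ) ≡ μ(r)μ(θ), an instance of the T-conversion
-- μ(ℓ) ≡ μ(r) since conversion is stable under substitution.  Folding over
-- the equivalence closure, μ preserves conversion of arbitrary terms.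

open import Defs
open import Data.Nat using (suc)
open import Data.Fin using (zero; suc)
open import Data.Bool using (Bool)
open import Data.Product using (_×_; _,_)
open import Function using (_∘_)
open import Relation.Binary.PropositionalEquality as P
  using (_≡_; _≗_; refl; cong; cong₂; sym; trans)
open import Relation.Binary.Construct.Closure.Equivalence as EqClosure
  using ()

extR-cong : ∀ {n m} {ρ ρ' : Ren n m} → ρ ≗ ρ' → extR ρ ≗ extR ρ'
extR-cong eq zero    = refl
extR-cong eq (suc i) = cong suc (eq i)

rename-cong : ∀ {n m} {ρ ρ' : Ren n m} → ρ ≗ ρ' → rename ρ ≗ rename ρ'
rename-cong eq (var x)   = cong var (eq x)
rename-cong eq (ocst c)  = refl
rename-cong eq (tcst a)  = refl
rename-cong eq (lam A t) = cong₂ lam (rename-cong eq A) (rename-cong (extR-cong eq) t)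
rename-cong eq (pi A t)  = cong₂ pi (rename-cong eq A) (rename-cong (extR-cong eq) t)
rename-cong eq (app t u) = cong₂ app (rename-cong eq t) (rename-cong eq u)
rename-cong eq type      = refl
rename-cong eq kind      = refl

extS-cong : ∀ {n m} {σ σ' : Sub n m} → σ ≗ σ' → extS σ ≗ extS σ'
extS-cong eq zero    = refl
extS-cong eq (suc i) = cong weaken (eq i)

subst-cong : ∀ {n m} {σ σ' : Sub n m} → σ ≗ σ' → subst σ ≗ subst σ'
subst-cong eq (var x)   = eq x
subst-cong eq (ocst c)  = refl
subst-cong eq (tcst a)  = refl
subst-cong eq (lam A t) = cong₂ lam (subst-cong eq A) (subst-cong (extS-cong eq) t)
subst-cong eq (pi A t)  = cong₂ pi (subst-cong eq A) (subst-cong (extS-cong eq) t)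
subst-cong eq (app t u) = cong₂ app (subst-cong eq t) (subst-cong eq u)
subst-cong eq type      = refl
subst-cong eq kind      = refl

extR-∘ : ∀ {n m k} (ρ : Ren m k) (ρ' : Ren n m) → extR ρ ∘ extR ρ' ≗ extR (ρ ∘ ρ')
extR-∘ ρ ρ' zero    = refl
extR-∘ ρ ρ' (suc i) = refl

rename-∘ : ∀ {n m k} (ρ : Ren m k) (ρ' : Ren n m) →
           rename ρ ∘ rename ρ' ≗ rename (ρ ∘ ρ')
rename-∘ ρ ρ' (var x)   = refl
rename-∘ ρ ρ' (ocst c)  = refl
rename-∘ ρ ρ' (tcst a)  = refl
rename-∘ ρ ρ' (lam A t) = cong₂ lam (rename-∘ ρ ρ' A)
  (trans (rename-∘ (extR ρ) (extR ρ') t) (rename-cong (extR-∘ ρ ρ') t))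
rename-∘ ρ ρ' (pi A t)  = cong₂ pi (rename-∘ ρ ρ' A)
  (trans (rename-∘ (extR ρ) (extR ρ') t) (rename-cong (extR-∘ ρ ρ') t))
rename-∘ ρ ρ' (app t u) = cong₂ app (rename-∘ ρ ρ' t) (rename-∘ ρ ρ' u)
rename-∘ ρ ρ' type      = refl
rename-∘ ρ ρ' kind      = refl

extS-extR : ∀ {n m k} (σ : Sub m k) (ρ : Ren n m) → extS σ ∘ extR ρ ≗ extS (σ ∘ ρ)
extS-extR σ ρ zero    = refl
extS-extR σ ρ (suc i) = refl

subst-rename : ∀ {n m k} (σ : Sub m k) (ρ : Ren n m) →
               subst σ ∘ rename ρ ≗ subst (σ ∘ ρ)
subst-rename σ ρ (var x)   = refl
subst-rename σ ρ (ocst c)  = refl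
subst-rename σ ρ (tcst a)  = refl
subst-rename σ ρ (lam A t) = cong₂ lam (subst-rename σ ρ A)
  (trans (subst-rename (extS σ) (extR ρ) t) (subst-cong (extS-extR σ ρ) t))
subst-rename σ ρ (pi A t)  = cong₂ pi (subst-rename σ ρ A)
  (trans (subst-rename (extS σ) (extR ρ) t) (subst-cong (extS-extR σ ρ) t))
subst-rename σ ρ (app t u) = cong₂ app (subst-rename σ ρ t) (subst-rename σ ρ u)
subst-rename σ ρ type      = refl
subst-rename σ ρ kind      = refl

rename-weaken : ∀ {n m} (ρ : Ren n m) (t : Term n) →
                rename (extR ρ) (weaken t) ≡ weaken (rename ρ t)
rename-weaken ρ t = trans (rename-∘ (extR ρ) suc t) (sym (rename-∘ suc ρ t))

extR-extS : ∀ {n m k} (ρ : Ren m k) (σ : Sub n m) →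
            rename (extR ρ) ∘ extS σ ≗ extS (rename ρ ∘ σ)
extR-extS ρ σ zero    = refl
extR-extS ρ σ (suc i) = rename-weaken ρ (σ i)

rename-subst : ∀ {n m k} (ρ : Ren m k) (σ : Sub n m) →
               rename ρ ∘ subst σ ≗ subst (rename ρ ∘ σ)
rename-subst ρ σ (var x)   = refl
rename-subst ρ σ (ocst c)  = refl
rename-subst ρ σ (tcst a)  = refl
rename-subst ρ σ (lam A t) = cong₂ lam (rename-subst ρ σ A)
  (trans (rename-subst (extR ρ) (extS σ) t) (subst-cong (extR-extS ρ σ) t))
rename-subst ρ σ (pi A t)  = cong₂ pi (rename-subst ρ σ A)
  (trans (rename-subst (extR ρ) (extS σ) t) (subst-cong (extR-extS ρ σ) t))
rename-subst ρ σ (app t u) = cong₂ app (rename-subst ρ σ t) (rename-subst ρ σ u)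
rename-subst ρ σ type      = refl
rename-subst ρ σ kind      = refl

subst-weaken : ∀ {n m} (σ : Sub n m) (t : Term n) →
               subst (extS σ) (weaken t) ≡ weaken (subst σ t)
subst-weaken σ t = trans (subst-rename (extS σ) suc t) (sym (rename-subst suc σ t))

extS-∘ : ∀ {n m k} (σ : Sub m k) (τ : Sub n m) →
         subst (extS σ) ∘ extS τ ≗ extS (subst σ ∘ τ)
extS-∘ σ τ zero    = refl
extS-∘ σ τ (suc i) = subst-weaken σ (τ i)

subst-∘ : ∀ {n m k} (σ : Sub m k) (τ : Sub n m) →
          subst σ ∘ subst τ ≗ subst (subst σ ∘ τ)
subst-∘ σ τ (var x)   = refl
subst-∘ σ τ (ocst c)  = refl
subst-∘ σ τ (tcst a)  = refl
subst-∘ σ τ (lam A t) = cong₂ lam (subst-∘ σ τ A)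
  (trans (subst-∘ (extS σ) (extS τ) t) (subst-cong (extS-∘ σ τ) t))
subst-∘ σ τ (pi A t)  = cong₂ pi (subst-∘ σ τ A)
  (trans (subst-∘ (extS σ) (extS τ) t) (subst-cong (extS-∘ σ τ) t))
subst-∘ σ τ (app t u) = cong₂ app (subst-∘ σ τ t) (subst-∘ σ τ u)
subst-∘ σ τ type      = refl
subst-∘ σ τ kind      = refl

extS-var : ∀ {n} → extS {n} var ≗ var
extS-var zero    = refl
extS-var (suc i) = refl

subst-var : ∀ {n} (t : Term n) → subst var t ≡ t
subst-var (var x)   = refl
subst-var (ocst c)  = refl
subst-var (tcst a)  = refl
subst-var (lam A t) = cong₂ lam (subst-var A) (trans (subst-cong extS-var t) (subst-var t))
subst-var (pi A t)  = cong₂ pi (subst-var A) (trans (subst-cong extS-var t) (subst-var t))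
subst-var (app t u) = cong₂ app (subst-var t) (subst-var u)
subst-var type      = refl
subst-var kind      = refl

single-extS : ∀ {n m} (σ : Sub n m) (u : Term n) →
              subst (single (subst σ u)) ∘ extS σ ≗ subst σ ∘ single u
single-extS σ u zero    = refl
single-extS σ u (suc i) = trans (subst-rename (single (subst σ u)) suc (σ i)) (subst-var (σ i))

subst-[] : ∀ {n m} (σ : Sub n m) (t : Term (suc n)) (u : Term n) →
           subst σ (t [ u ]) ≡ subst (extS σ) t [ subst σ u ]
subst-[] σ t u = begin
  subst σ (subst (single u) t)                       ≡⟨ subst-∘ σ (single u) t ⟩
  subst (subst σ ∘ single u) t                       ≡⟨ subst-cong (single-extS σ u) t ⟨
  subst (subst (single (subst σ u)) ∘ extS σ) t      ≡⟨ subst-∘ (single (subst σ u)) (extS σ) t ⟨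
  subst (single (subst σ u)) (subst (extS σ) t)      ∎
  where open P.≡-Reasoning

rename-weakenClosed : ∀ {n m} (ρ : Ren n m) (M : Term 0) →
                      rename ρ (weakenClosed M) ≡ weakenClosed M
rename-weakenClosed ρ M = trans (rename-∘ ρ close→ M) (rename-cong (λ ()) M)

subst-weakenClosed : ∀ {n m} (σ : Sub n m) (M : Term 0) →
                     subst σ (weakenClosed M) ≡ weakenClosed M
subst-weakenClosed σ M = begin
  subst σ (rename close→ M)          ≡⟨ subst-rename σ close→ M ⟩
  subst (σ ∘ close→) M               ≡⟨ subst-cong (λ ()) M ⟩
  subst (var ∘ close→) M             ≡⟨ subst-rename var close→ M ⟨
  subst var (rename close→ M)        ≡⟨ subst-var (rename close→ M) ⟩
  rename close→ M                    ∎
  where open P.≡-Reasoning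

module _ (μ : MorphData) where

  applyμ-rename : ∀ {n m} (ρ : Ren n m) → applyμ μ ∘ rename ρ ≗ rename ρ ∘ applyμ μ
  applyμ-rename ρ (var x)   = refl
  applyμ-rename ρ (ocst c)  = sym (rename-weakenClosed ρ _)
  applyμ-rename ρ (tcst a)  = sym (rename-weakenClosed ρ _)
  applyμ-rename ρ (lam A t) = cong₂ lam (applyμ-rename ρ A) (applyμ-rename (extR ρ) t)
  applyμ-rename ρ (pi A t)  = cong₂ pi (applyμ-rename ρ A) (applyμ-rename (extR ρ) t)
  applyμ-rename ρ (app t u) = cong₂ app (applyμ-rename ρ t) (applyμ-rename ρ u)
  applyμ-rename ρ type      = refl
  applyμ-rename ρ kind      = refl

  applyμ-extS : ∀ {n m} (σ : Sub n m) → applyμ μ ∘ extS σ ≗ extS (applyμ μ ∘ σ)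
  applyμ-extS σ zero    = refl
  applyμ-extS σ (suc i) = applyμ-rename suc (σ i)

  applyμ-subst : ∀ {n m} (σ : Sub n m) →
                 applyμ μ ∘ subst σ ≗ subst (applyμ μ ∘ σ) ∘ applyμ μ
  applyμ-subst σ (var x)   = refl
  applyμ-subst σ (ocst c)  = sym (subst-weakenClosed _ _)
  applyμ-subst σ (tcst a)  = sym (subst-weakenClosed _ _)
  applyμ-subst σ (lam A t) = cong₂ lam (applyμ-subst σ A)
    (trans (applyμ-subst (extS σ) t) (subst-cong (applyμ-extS σ) (applyμ μ t)))
  applyμ-subst σ (pi A t)  = cong₂ pi (applyμ-subst σ A)
    (trans (applyμ-subst (extS σ) t) (subst-cong (applyμ-extS σ) (applyμ μ t)))
  applyμ-subst σ (app t u) = cong₂ app (applyμ-subst σ t) (applyμ-subst σ u)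
  applyμ-subst σ type      = refl
  applyμ-subst σ kind      = refl

  applyμ-single : ∀ {n} (u : Term n) → applyμ μ ∘ single u ≗ single (applyμ μ u)
  applyμ-single u zero    = refl
  applyμ-single u (suc i) = refl

  applyμ-[] : ∀ {n} (t : Term (suc n)) (u : Term n) →
              applyμ μ (t [ u ]) ≡ applyμ μ t [ applyμ μ u ]
  applyμ-[] t u = trans (applyμ-subst (single u) t) (subst-cong (applyμ-single u) (applyμ μ t))

module _ {eta : Bool} {T : Theory} where

  step-subst : ∀ {n m} (σ : Sub n m) {a b : Term n} →
               Step eta T a b → Step eta T (subst σ a) (subst σ b)
  step-subst σ (β A t u)            =
    P.subst (Step eta T _) (sym (subst-[] σ t u)) (β _ _ _)
  step-subst σ (η e t A)            =
    P.subst (Step eta T _) (cong (λ w → lam _ (app w (var zero))) (sym (subst-weaken σ t)))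
            (η e _ _)
  step-subst σ (rw {ℓ = ℓ} {r} d θ) =
    P.subst₂ (Step eta T) (sym (subst-∘ σ θ ℓ)) (sym (subst-∘ σ θ r)) (rw d _)
  step-subst σ (lamˡ s)             = lamˡ (step-subst σ s)
  step-subst σ (lamʳ s)             = lamʳ (step-subst (extS σ) s)
  step-subst σ (piˡ s)              = piˡ (step-subst σ s)
  step-subst σ (piʳ s)              = piʳ (step-subst (extS σ) s)
  step-subst σ (appˡ s)             = appˡ (step-subst σ s)
  step-subst σ (appʳ s)             = appʳ (step-subst σ s)

  conv-subst : ∀ {n m} (σ : Sub n m) {a b : Term n} →
               Conv eta T a b → Conv eta T (subst σ a) (subst σ b)
  conv-subst σ = EqClosure.gmap (subst σ) (step-subst σ)

module _ {eta : Bool} {S T : Theory} {μ : MorphData}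
         (isMorphism : IsTheoryMorphism eta S T μ) where

  applyμ-step : ∀ {n} {a b : Term n} →
                Step eta S a b → Conv eta T (applyμ μ a) (applyμ μ b)
  applyμ-step (β A t u)            =
    P.subst (Conv eta T _) (sym (applyμ-[] μ t u)) (EqClosure.return (β _ _ _))
  applyμ-step (η e t A)            =
    P.subst (Conv eta T _) (cong (λ w → lam _ (app w (var zero))) (sym (applyμ-rename μ suc t)))
            (EqClosure.return (η e _ _))
  applyμ-step (rw {ℓ = ℓ} {r} d θ) =
    P.subst₂ (Conv eta T) (sym (applyμ-subst μ θ ℓ)) (sym (applyμ-subst μ θ r))
             (conv-subst _ (IsTheoryMorphism.on-rule isMorphism d))
  applyμ-step (lamˡ s)             = EqClosure.gmap _ lamˡ (applyμ-step s)
  applyμ-step (lamʳ s)             = EqClosure.gmap _ lamʳ (applyμ-step s)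
  applyμ-step (piˡ s)              = EqClosure.gmap _ piˡ (applyμ-step s)
  applyμ-step (piʳ s)              = EqClosure.gmap _ piʳ (applyμ-step s)
  applyμ-step (appˡ s)             = EqClosure.gmap _ appˡ (applyμ-step s)
  applyμ-step (appʳ s)             = EqClosure.gmap _ appʳ (applyμ-step s)

  applyμ-conv : ∀ {n} {a b : Term n} →
                Conv eta S a b → Conv eta T (applyμ μ a) (applyμ μ b)
  applyμ-conv = EqClosure.gfold (EqClosure.isEquivalence _) (applyμ μ) applyμ-step

mainTheorem3 : (eta : Bool) (S T : Theory) (μ : MorphData) →
               IsTheoryMorphism eta S T μ →
               (∀ {n} (A B : Term n) → IsTy A → IsTy B →
                  Conv eta S A B → Conv eta T (applyμ μ A) (applyμ μ B))
               ×
               (∀ {n} (K K' : Term n) → IsKind K → IsKind K' →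
                  Conv eta S K K' → Conv eta T (applyμ μ K) (applyμ μ K'))
mainTheorem3 eta S T μ isMorphism =
  (λ _ _ _ _ → applyμ-conv isMorphism) , (λ _ _ _ _ → applyμ-conv isMorphism)
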